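{- Let $X=[x_{ij}]$ be an $n\times n$ doubly stochastic matrix such that all diagonals of $X$ avoiding the zero entries of $X$ have the same diagonal sum. Let $X'$ be the $2\times 2$ submatrix of $X$ in rows $i,i'$ and columns $j,j'$, and suppose all entries of $X'$ are positive and the complementary $(n-2)\times(n-2)$ submatrix $X''$ (obtained by deleting rows $i,i'$ and columns $j,j'$) has term rank $n-2$. Then the two diagonals of $X'$ have the same sum: $x_{ij}+x_{i'j'}=x_{ij'}+x_{i'j}$.
   Context: A square nonnegative matrix is doubly stochastic if all row and column sums equal $1$. For a permutation $\sigma$ of $\{1,\ldots,n\}$, the diagonal of $X$ corresponding to $\sigma$ is the set of positions $(i,\sigma(i))$, with diagonal sum $\sum_i x_{i,\sigma(i)}$; it avoids the zero entries if $x_{i,\sigma(i)}\ne 0$ for all $i$. The term rank of a matrix is the maximum number of nonzero entries no two of which lie in the same row or column. -}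

module Defs where

open import Level using (Level; _⊔_; suc)
open import Data.Nat using (ℕ; zero) renaming (suc to sucℕ)
open import Data.Fin using (Fin) renaming (zero to fz; suc to fs)
open import Data.Fin.Permutation using (Permutation′; _⟨$⟩ʳ_)
open import Data.Product using (Σ; _×_; ∃)
open import Relation.Nullary using (¬_)
open import Relation.Binary.PropositionalEquality using (_≡_)
open import Relation.Binary.Core using (Rel)
open import Relation.Binary.Structures using (IsTotalOrder)
open import Algebra.Bundles using (CommutativeRing)

record OrderedCommRing (c ℓ₁ ℓ₂ : Level) : Set (suc (c ⊔ ℓ₁ ⊔ ℓ₂)) where
  field
    commRing : CommutativeRing c ℓ₁
  open CommutativeRing commRing public
  field
    _≤_         : Rel Carrier ℓ₂
    isTotalOrder : IsTotalOrder _≈_ _≤_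
    +-mono-≤    : ∀ {x y} z → x ≤ y → (x + z) ≤ (y + z)
    *-nonneg    : ∀ {x y} → 0# ≤ x → 0# ≤ y → 0# ≤ (x * y)

module Matrices {c ℓ₁ ℓ₂} (R : OrderedCommRing c ℓ₁ ℓ₂) where
  open OrderedCommRing R

  Matrix : ℕ → Set c
  Matrix n = Fin n → Fin n → Carrier

  ∑ : ∀ {n} → (Fin n → Carrier) → Carrier
  ∑ {zero}   f = 0#
  ∑ {sucℕ n} f = f fz + ∑ (λ k → f (fs k))

  Nonzero : Carrier → Set ℓ₁
  Nonzero x = ¬ (x ≈ 0#)

  Positive : Carrier → Set (ℓ₁ ⊔ ℓ₂)
  Positive x = (0# ≤ x) × Nonzero x

  DoublyStochastic : ∀ {n} → Matrix n → Set (ℓ₁ ⊔ ℓ₂)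
  DoublyStochastic {n} X =
    (∀ i j → 0# ≤ X i j) ×
    (∀ i → ∑ (λ j → X i j) ≈ 1#) ×
    (∀ j → ∑ (λ i → X i j) ≈ 1#)

  diagSum : ∀ {n} → Matrix n → Permutation′ n → Carrier
  diagSum X σ = ∑ (λ i → X i (σ ⟨$⟩ʳ i))

  AvoidsZeros : ∀ {n} → Matrix n → Permutation′ n → Set ℓ₁
  AvoidsZeros X σ = ∀ i → Nonzero (X i (σ ⟨$⟩ʳ i))

  TermRankAtLeast : ∀ {n} → Matrix n → (Row Col : Fin n → Set) → ℕ → Set ℓ₁
  TermRankAtLeast {n} X Row Col k =
    Σ (Fin k → Fin n) λ r → Σ (Fin k → Fin n) λ s →
      (∀ t → Row (r t)) × (∀ t → Col (s t)) ×
      (∀ t u → r t ≡ r u → t ≡ u) × (∀ t u → s t ≡ s u → t ≡ u) ×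
      (∀ t → Nonzero (X (r t) (s t)))

  HasTermRank : ∀ {n} → Matrix n → (Row Col : Fin n → Set) → ℕ → Set ℓ₁
  HasTermRank X Row Col k =
    TermRankAtLeast X Row Col k × ¬ TermRankAtLeast X Row Col (sucℕ k)

-- Extend a transversal of nonzero entries of X″ by either diagonal of X′.
-- This gives two diagonals of X avoiding its zero entries, so their sums
-- agree; they share all entries outside X′, which then cancel.
module Submission where

open import Defs
open import Level using (Level)
open import Data.Nat using (ℕ; _∸_; zero; suc)
open import Data.Nat.Properties using (1+n≰n)
open import Data.Fin using (Fin; punchOut) renaming (zero to fz; suc to fs)
open import Data.Fin.Permutation
  using (Permutation′; permutation; _⟨$⟩ʳ_; _⟨$⟩ˡ_; flip; _∘ₚ_; inverseˡ; inverseʳ)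
open import Data.Fin.Properties using (any?; punchOut-injective; injective⇒≤; _≟_)
open import Data.Vec.Functional using (_∷_)
open import Data.Product using (_×_; _,_; proj₁; proj₂; ∃; swap)
open import Data.Empty using (⊥-elim)
open import Function.Base using (_∘_)
open import Function.Definitions using (Injective)
open import Relation.Nullary using (yes; no)
open import Relation.Binary.PropositionalEquality
  using (_≡_; _≢_; refl; sym; cong; subst)
import Algebra.Properties.CommutativeMonoid.Sum as MonoidSum
import Algebra.Properties.Group as GroupProperties
import Relation.Binary.Reasoning.Setoid as SetoidReasoning

private
  variable
    a : Level
    A : Set a
    n : ℕ

injective⇒surjective : {f : Fin n → Fin n} → Injective _≡_ _≡_ f → ∀ y → ∃ λ x → f x ≡ y
injective⇒surjective {zero}  _ ()
injective⇒surjective {suc n} {f} f-inj y with any? (λ x → f x ≟ y)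
... | yes hit = hit
... | no miss = ⊥-elim (1+n≰n (injective⇒≤ {f = f′} f′-inj))
  where
  f≢y : ∀ x → y ≢ f x
  f≢y x eq = miss (x , sym eq)

  f′ : Fin (suc n) → Fin n
  f′ x = punchOut (f≢y x)

  f′-inj : Injective _≡_ _≡_ f′
  f′-inj {x} {z} eq = f-inj (punchOut-injective (f≢y x) (f≢y z) eq)

injective⇒permutation : (f : Fin n → Fin n) → Injective _≡_ _≡_ f → Permutation′ n
injective⇒permutation f f-inj = permutation f f⁻¹
  (λ y → proj₂ (injective⇒surjective f-inj y))
  (λ x → f-inj (proj₂ (injective⇒surjective f-inj (f x))))
  where
  f⁻¹ = λ y → proj₁ (injective⇒surjective f-inj y)

∷-injective : ∀ {x} {f : Fin n → A} → (∀ t → f t ≢ x) → Injective _≡_ _≡_ f →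
              Injective _≡_ _≡_ (x ∷ f)
∷-injective x∉f f-inj {fz}   {fz}   _  = refl
∷-injective x∉f f-inj {fz}   {fs u} eq = ⊥-elim (x∉f u (sym eq))
∷-injective x∉f f-inj {fs t} {fz}   eq = ⊥-elim (x∉f t eq)
∷-injective x∉f f-inj {fs t} {fs u} eq = cong fs (f-inj eq)

∷∷-injective : ∀ {x y} {f : Fin n → A} → x ≢ y → (∀ t → f t ≢ x) → (∀ t → f t ≢ y) →
               Injective _≡_ _≡_ f → Injective _≡_ _≡_ (x ∷ y ∷ f)
∷∷-injective {x = x} {y} {f} x≢y x∉f y∉f f-inj = ∷-injective x∉yf (∷-injective y∉f f-inj)
  where
  x∉yf : ∀ t → (y ∷ f) t ≢ x
  x∉yf fz     = λ y≡x → x≢y (sym y≡x)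
  x∉yf (fs t) = x∉f t

transversal : (ρ κ : Fin n → Fin n) → Injective _≡_ _≡_ ρ → Injective _≡_ _≡_ κ →
              Permutation′ n
transversal ρ κ ρ-inj κ-inj = flip (injective⇒permutation ρ ρ-inj) ∘ₚ injective⇒permutation κ κ-inj

module _ (ρ κ : Fin n → Fin n) (ρ-inj : Injective _≡_ _≡_ ρ) (κ-inj : Injective _≡_ _≡_ κ) where

  private
    σ = transversal ρ κ ρ-inj κ-inj
    Pρ = injective⇒permutation ρ ρ-inj

  transversal-apply : ∀ t → σ ⟨$⟩ʳ ρ t ≡ κ t
  transversal-apply t = cong κ (inverseˡ Pρ)

  transversal-all : ∀ {ℓ} (P : Fin n → Fin n → Set ℓ) → (∀ t → P (ρ t) (κ t)) →
                    ∀ k → P k (σ ⟨$⟩ʳ k)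
  transversal-all P P-ρκ k =
    subst (λ k′ → P k′ (σ ⟨$⟩ʳ k′)) (inverseʳ Pρ)
      (subst (P (ρ (Pρ ⟨$⟩ˡ k))) (sym (transversal-apply (Pρ ⟨$⟩ˡ k))) (P-ρκ (Pρ ⟨$⟩ˡ k)))

module Transversals {c ℓ₁ ℓ₂} (R : OrderedCommRing c ℓ₁ ℓ₂) where
  open OrderedCommRing R hiding (refl; sym)
  open Matrices R
  open MonoidSum +-commutativeMonoid using (sum; sum-permute; sum-cong-≗)
  open SetoidReasoning setoid

  ∑≡sum : (f : Fin n → Carrier) → ∑ f ≡ sum f
  ∑≡sum {zero}  f = refl
  ∑≡sum {suc n} f = cong (f fz +_) (∑≡sum (λ t → f (fs t)))

  module _ (X : Matrix n) (ρ κ : Fin n → Fin n)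
           (ρ-inj : Injective _≡_ _≡_ ρ) (κ-inj : Injective _≡_ _≡_ κ) where

    private
      σ = transversal ρ κ ρ-inj κ-inj

    diagSum-transversal : diagSum X σ ≈ ∑ (λ t → X (ρ t) (κ t))
    diagSum-transversal = begin
      ∑ (λ k → X k (σ ⟨$⟩ʳ k))          ≡⟨ ∑≡sum (λ k → X k (σ ⟨$⟩ʳ k)) ⟩
      sum (λ k → X k (σ ⟨$⟩ʳ k))        ≈⟨ sum-permute _ (injective⇒permutation ρ ρ-inj) ⟩
      sum (λ t → X (ρ t) (σ ⟨$⟩ʳ ρ t))  ≡⟨ sum-cong-≗ (λ t → cong (X (ρ t)) (transversal-apply ρ κ ρ-inj κ-inj t)) ⟩
      sum (λ t → X (ρ t) (κ t))         ≡⟨ sym (∑≡sum (λ t → X (ρ t) (κ t))) ⟩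
      ∑ (λ t → X (ρ t) (κ t))           ∎

    transversal-avoidsZeros : (∀ t → Nonzero (X (ρ t) (κ t))) → AvoidsZeros X σ
    transversal-avoidsZeros = transversal-all ρ κ ρ-inj κ-inj (λ k l → Nonzero (X k l))

  ZeroFreeDiagonalSum : Matrix n → Carrier → Set ℓ₁
  ZeroFreeDiagonalSum X a = ∃ λ σ → AvoidsZeros X σ × diagSum X σ ≈ a

  extend-transversal : ∀ {m} (X : Matrix (suc (suc m))) {i i′ j j′} {r s : Fin m → Fin (suc (suc m))} →
    i ≢ i′ → j ≢ j′ → (∀ t → (r t ≢ i) × (r t ≢ i′)) → (∀ t → (s t ≢ j) × (s t ≢ j′)) →
    Injective _≡_ _≡_ r → Injective _≡_ _≡_ s →
    Nonzero (X i j) → Nonzero (X i′ j′) → (∀ t → Nonzero (X (r t) (s t))) →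
    ZeroFreeDiagonalSum X (X i j + (X i′ j′ + ∑ (λ t → X (r t) (s t))))
  extend-transversal X {i} {i′} {j} {j′} {r} {s} i≢i′ j≢j′ r-avoids s-avoids r-inj s-inj xij≢0 xi′j′≢0 rs≢0 =
    transversal ρ κ ρ-inj κ-inj ,
    transversal-avoidsZeros X ρ κ ρ-inj κ-inj ρκ≢0 ,
    diagSum-transversal X ρ κ ρ-inj κ-inj
    where
    ρ = i ∷ i′ ∷ r
    κ = j ∷ j′ ∷ s

    ρ-inj : Injective _≡_ _≡_ ρ
    ρ-inj = ∷∷-injective i≢i′ (proj₁ ∘ r-avoids) (proj₂ ∘ r-avoids) r-inj

    κ-inj : Injective _≡_ _≡_ κ
    κ-inj = ∷∷-injective j≢j′ (proj₁ ∘ s-avoids) (proj₂ ∘ s-avoids) s-inj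

    ρκ≢0 : ∀ t → Nonzero (X (ρ t) (κ t))
    ρκ≢0 fz           = xij≢0
    ρκ≢0 (fs fz)      = xi′j′≢0
    ρκ≢0 (fs (fs t)) = rs≢0 t

lemma4p1 : ∀ {c ℓ₁ ℓ₂} (R : OrderedCommRing c ℓ₁ ℓ₂) → let open OrderedCommRing R in let open Matrices R in
    (n : ℕ) (X : Matrix n) →
    DoublyStochastic X →
    (∀ (σ τ : Permutation′ n) → AvoidsZeros X σ → AvoidsZeros X τ → diagSum X σ ≈ diagSum X τ) →
    (i i′ j j′ : Fin n) → i ≢ i′ → j ≢ j′ →
    Positive (X i j) → Positive (X i j′) → Positive (X i′ j) → Positive (X i′ j′) →
    HasTermRank X (λ r → (r ≢ i) × (r ≢ i′)) (λ s → (s ≢ j) × (s ≢ j′)) (n ∸ 2) →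
    X i j + X i′ j′ ≈ X i j′ + X i′ j
lemma4p1 R zero X _ _ () _ _ _ _ _ _ _ _ _ _
lemma4p1 R (suc zero) X _ _ fz fz _ _ i≢i′ _ _ _ _ _ _ = ⊥-elim (i≢i′ refl)
lemma4p1 R (suc (suc m)) X _ equalDiagSums i i′ j j′ i≢i′ j≢j′ xij>0 xij′>0 xi′j>0 xi′j′>0
  ((r , s , r-avoids , s-avoids , r-inj , s-inj , rs≢0) , _) =
  ∙-cancelʳ C _ _ (begin
    X i j + X i′ j′ + C    ≈⟨ +-assoc _ _ _ ⟩
    X i j + (X i′ j′ + C)  ≈⟨ zeroFreeDiagonalSums-agree diagonal antidiagonal ⟩
    X i j′ + (X i′ j + C)  ≈⟨ +-assoc _ _ _ ⟨
    X i j′ + X i′ j + C    ∎)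
  where
  open OrderedCommRing R hiding (refl; sym)
  open Matrices R
  open Transversals R
  open GroupProperties +-group using (∙-cancelʳ)
  open SetoidReasoning setoid

  C = ∑ (λ t → X (r t) (s t))

  zeroFreeDiagonalSums-agree : ∀ {a b} → ZeroFreeDiagonalSum X a → ZeroFreeDiagonalSum X b → a ≈ b
  zeroFreeDiagonalSums-agree (σ , σ≢0 , σ-sum) (τ , τ≢0 , τ-sum) = begin
    _            ≈⟨ σ-sum ⟨
    diagSum X σ  ≈⟨ equalDiagSums σ τ σ≢0 τ≢0 ⟩
    diagSum X τ  ≈⟨ τ-sum ⟩
    _            ∎

  diagonal : ZeroFreeDiagonalSum X (X i j + (X i′ j′ + C))
  diagonal = extend-transversal X i≢i′ j≢j′ r-avoids s-avoids (r-inj _ _) (s-inj _ _)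
           (proj₂ xij>0) (proj₂ xi′j′>0) rs≢0

  antidiagonal : ZeroFreeDiagonalSum X (X i j′ + (X i′ j + C))
  antidiagonal = extend-transversal X i≢i′ (j≢j′ ∘ sym) r-avoids (swap ∘ s-avoids) (r-inj _ _) (s-inj _ _)
           (proj₂ xij′>0) (proj₂ xi′j>0) rs≢0
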